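{- For all integers $n$ and $i$ with $0 \leq i \leq n-3$, $x_{n - 1} + x_{n - 2} \leq x_{n - 1 + i} + x_{n - 2 - i}$.
   Context: The sequence $(x_n)_{n\ge1}$ is defined by $x_1 = 0, x_2 = 1, x_3 = 2, x_4 = 4, x_5 = 5$ and, for $n \geq 6$, $$x_n = (n - 1) + \begin{cases} x_{\frac{n + 1}{2}} + x_{\frac{n - 3}{2}}, & n \equiv 1 \pmod 4,\\ 2 x_{\frac{n - 1}{2}}, & n \equiv 3 \pmod 4,\\ x_{\frac{n}{2}} + x_{\frac{n - 2}{2}}, & n \text{ even}. \end{cases}$$ -}

module Defs where

open import Data.Nat using (ℕ; zero; suc; _+_; _*_; _∸_)
open import Data.Nat.DivMod using (_/_; _%_)

-- Fuel-indexed evaluator for the recursion.  Every recursive call is on a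
-- strictly smaller index, so fuel n suffices to compute x n for n ≥ 1.
mutual
  xf : ℕ → ℕ → ℕ
  xf zero    _ = 0
  xf (suc f) 0 = 0
  xf (suc f) 1 = 0
  xf (suc f) 2 = 1
  xf (suc f) 3 = 2
  xf (suc f) 4 = 4
  xf (suc f) 5 = 5
  xf (suc f) n@(suc (suc (suc (suc (suc (suc _)))))) = step f n (n % 4)

  step : ℕ → ℕ → ℕ → ℕ
  step f n 1 = (n ∸ 1) + (xf f ((n + 1) / 2) + xf f ((n ∸ 3) / 2))
  step f n 3 = (n ∸ 1) + 2 * xf f ((n ∸ 1) / 2)
  step f n _ = (n ∸ 1) + (xf f (n / 2) + xf f ((n ∸ 2) / 2))   -- n even

-- The sequence (x_n)_{n ≥ 1}; x 0 = 0 is a dummy value.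
x : ℕ → ℕ
x n = xf n n

open import Relation.Binary.PropositionalEquality using (_≡_; refl)
_ : x 6 ≡ 5 + (x 3 + x 2)
_ = refl
_ : x 7 ≡ 6 + 2 * x 3
_ = refl
_ : x 9 ≡ 8 + (x 5 + x 3)
_ = refl
_ : x 12 ≡ 11 + (x 6 + x 5)
_ = refl

-- Write Δ k = x (k + 1) − x k.  Unfolding the recursion at n = 4s+6, …, 4s+9 gives
--   Δ (4s+6) = 1 + Δ (2s+2),  Δ (4s+7) = 1 + Δ (2s+3),
--   Δ (4s+8) = 1 + Δ (2s+4),  Δ (4s+9) = 1 + Δ (2s+3),
-- so Δ k ≤ Δ (k + 2) follows by strong induction: in two cases it is an equality, in
-- the other two it is the same inequality at about half the index.  Hence the
-- increments of x grow along each parity class, and the corollary follows by pairing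
-- the increment at m − 1 − j with the one at m + 1 + j (m = n − 2, j < i), an even
-- distance apart.
module Submission where

open import Defs
open import Data.Fin using (zero; suc)
open import Data.List using ([]; _∷_)
open import Data.Nat using (ℕ; zero; suc; _+_; _*_; _∸_; _≤_; _<_; s≤s)
open import Data.Nat.DivMod using (_/_; _%_; _divMod_; result; m*n/n≡m; m<n*o⇒m/o<n; [m+kn]%n≡m%n)
open import Data.Nat.Induction using (<-rec)
open import Data.Nat.Properties
open import Data.Nat.Tactic.RingSolver using (solve)
open import Data.Product using (_,_)
open import Relation.Binary.PropositionalEquality
open import Algebra.Properties.CommutativeSemigroup +-commutativeSemigroup using (xy∙z≈xz∙y; xy∙z≈zy∙x)

-- Δ≤Δ f m n : f (m+1) − f m ≤ f (n+1) − f n, and Δ≡1+Δ f n m : f (n+1) − f n = 1 + (f (m+1) − f m),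
-- both stated additively to avoid truncated subtraction.
record Δ≤Δ (f : ℕ → ℕ) (m n : ℕ) : Set where
  constructor mkΔ≤Δ
  field ≤-of-Δ≤Δ : f (1 + m) + f n ≤ f m + f (1 + n)

record Δ≡1+Δ (f : ℕ → ℕ) (n m : ℕ) : Set where
  constructor mkΔ≡1+Δ
  field ≡-of-Δ≡1+Δ : f (1 + n) + f m ≡ 1 + f n + f (1 + m)

open Δ≤Δ

ParityConvex : (ℕ → ℕ) → Set
ParityConvex f = ∀ n → Δ≤Δ f n (2 + n)

module _ {f : ℕ → ℕ} where

  Δ≤Δ-refl : ∀ {m} → Δ≤Δ f m m
  Δ≤Δ-refl {m} = mkΔ≤Δ (≤-reflexive (+-comm (f (1 + m)) (f m)))

  Δ≤Δ-trans : ∀ {k l m} → Δ≤Δ f k l → Δ≤Δ f l m → Δ≤Δ f k m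
  Δ≤Δ-trans {k} {l} {m} (mkΔ≤Δ kl) (mkΔ≤Δ lm) =
    mkΔ≤Δ (cancel (f (1 + k)) (f l) (f k) (f (1 + l)) (f m) (f (1 + m)) kl lm)
    where
    cancel : ∀ a b c d e g → a + b ≤ c + d → d + e ≤ b + g → a + e ≤ c + g
    cancel a b c d e g ab≤cd de≤bg = +-cancelʳ-≤ (b + d) (a + e) (c + g) (begin
      a + e + (b + d)   ≡⟨ solve (a ∷ b ∷ d ∷ e ∷ []) ⟩
      (a + b) + (d + e) ≤⟨ +-mono-≤ ab≤cd de≤bg ⟩
      (c + d) + (b + g) ≡⟨ solve (b ∷ c ∷ d ∷ g ∷ []) ⟩
      c + g + (b + d)   ∎)
      where open ≤-Reasoning

  Δ≡1+Δ-intro : ∀ {n m} k {u v} → f n ≡ k + u → f (1 + n) ≡ suc k + v →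
                v + f m ≡ u + f (1 + m) → Δ≡1+Δ f n m
  Δ≡1+Δ-intro {n} {m} k {u} {v} fn≡ f1+n≡ v≡u = mkΔ≡1+Δ (begin
    f (1 + n) + f m          ≡⟨ cong (_+ f m) f1+n≡ ⟩
    suc k + v + f m          ≡⟨ +-assoc (suc k) v (f m) ⟩
    suc k + (v + f m)        ≡⟨ cong (suc k +_) v≡u ⟩
    suc k + (u + f (1 + m))  ≡⟨ cong suc (+-assoc k u (f (1 + m))) ⟨
    suc (k + u + f (1 + m))  ≡⟨ cong (λ z → suc (z + f (1 + m))) fn≡ ⟨
    1 + f n + f (1 + m)      ∎)
    where open ≡-Reasoning

  Δ≡1+Δ-mono : ∀ {n m n′ m′} → Δ≡1+Δ f n m → Δ≡1+Δ f n′ m′ → Δ≤Δ f m m′ → Δ≤Δ f n n′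
  Δ≡1+Δ-mono {n} {m} {n′} {m′} (mkΔ≡1+Δ nm) (mkΔ≡1+Δ nm′) (mkΔ≤Δ mm′) =
    mkΔ≤Δ (shift (f (1 + n)) (f n) (f (1 + m)) (f m) (f (1 + n′)) (f n′) (f (1 + m′)) (f m′) nm nm′ mm′)
    where
    shift : ∀ A a B b C c D d → A + b ≡ 1 + a + B → C + d ≡ 1 + c + D → B + d ≤ b + D → A + c ≤ a + C
    shift A a B b C c D d A≡ C≡ B≤D = +-cancelʳ-≤ (b + d) (A + c) (a + C) (begin
      A + c + (b + d)         ≡⟨ solve (A ∷ b ∷ c ∷ d ∷ []) ⟩
      (A + b) + (c + d)       ≡⟨ cong (_+ (c + d)) A≡ ⟩
      (1 + a + B) + (c + d)   ≡⟨ solve (a ∷ B ∷ c ∷ d ∷ []) ⟩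
      (1 + a + c) + (B + d)   ≤⟨ +-monoʳ-≤ (1 + a + c) B≤D ⟩
      (1 + a + c) + (b + D)   ≡⟨ solve (a ∷ b ∷ c ∷ D ∷ []) ⟩
      (a + b) + (1 + c + D)   ≡⟨ cong ((a + b) +_) C≡ ⟨
      (a + b) + (C + d)       ≡⟨ solve (a ∷ b ∷ C ∷ d ∷ []) ⟩
      a + C + (b + d)         ∎)
      where open ≤-Reasoning

  module _ (convex : ParityConvex f) where

    ParityConvex⇒Δ≤Δ-even : ∀ j k → Δ≤Δ f k (j * 2 + k)
    ParityConvex⇒Δ≤Δ-even zero    k = Δ≤Δ-refl
    ParityConvex⇒Δ≤Δ-even (suc j) k = Δ≤Δ-trans (ParityConvex⇒Δ≤Δ-even j k) (convex (j * 2 + k))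

    ParityConvex⇒spread-+ : ∀ i a → f (i + a) + f (1 + i + a) ≤ f a + f (1 + i * 2 + a)
    ParityConvex⇒spread-+ zero    a = ≤-refl
    ParityConvex⇒spread-+ (suc i) a = ≤-trans inner (≤-of-Δ≤Δ (ParityConvex⇒Δ≤Δ-even (suc i) a))
      where
      inner : f (1 + i + a) + f (2 + i + a) ≤ f (1 + a) + f (2 + i * 2 + a)
      inner = subst₂ (λ p q → f p + f (1 + p) ≤ f (1 + a) + f (1 + q)) (+-suc i a) (+-suc (i * 2) a)
                (ParityConvex⇒spread-+ i (suc a))

    ParityConvex⇒spread : ∀ {i m} → i ≤ m → f (1 + m) + f m ≤ f (1 + m + i) + f (m ∸ i)
    ParityConvex⇒spread {i} i≤m with m≤n⇒∃[o]m+o≡n i≤m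
    ... | a , refl = begin
      f (1 + (i + a)) + f (i + a)     ≡⟨ +-comm (f (1 + (i + a))) (f (i + a)) ⟩
      f (i + a) + f (1 + (i + a))     ≤⟨ ParityConvex⇒spread-+ i a ⟩
      f a + f (1 + i * 2 + a)         ≡⟨ +-comm (f a) (f (1 + i * 2 + a)) ⟩
      f (1 + i * 2 + a) + f a         ≡⟨ cong₂ (λ p q → f p + f q) (solve (i ∷ a ∷ [])) (m+n∸m≡n i a) ⟨
      f (1 + (i + a) + i) + f (i + a ∸ i) ∎
      where open ≤-Reasoning

half-≤ : ∀ {m} k → m ≤ 7 + k → m / 2 ≤ 5 + k
half-≤ {m} k m≤7+k = ≤-pred (m<n*o⇒m/o<n (≤-<-trans m≤7+k 7+k<[6+k]*2))
  where
  7+k<[6+k]*2 : 7 + k < (6 + k) * 2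
  7+k<[6+k]*2 = ≤-trans (m≤m+n (8 + k) (4 + k)) (≤-reflexive (solve (k ∷ [])))

mutual
  xf-fuel-irrelevant : ∀ {f g} j → j ≤ suc f → j ≤ suc g → xf (suc f) j ≡ xf (suc g) j
  xf-fuel-irrelevant 0 _ _ = refl
  xf-fuel-irrelevant 1 _ _ = refl
  xf-fuel-irrelevant 2 _ _ = refl
  xf-fuel-irrelevant 3 _ _ = refl
  xf-fuel-irrelevant 4 _ _ = refl
  xf-fuel-irrelevant 5 _ _ = refl
  xf-fuel-irrelevant j@(suc (suc (suc (suc (suc (suc k)))))) (s≤s p) (s≤s q) =
    step-fuel-irrelevant k (j % 4) p q

  step-fuel-irrelevant : ∀ {f g} k r → 5 + k ≤ f → 5 + k ≤ g → step f (6 + k) r ≡ step g (6 + k) r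
  step-fuel-irrelevant k 1 p@(s≤s _) q@(s≤s _) = cong (5 + k +_) (cong₂ _+_
    (xf-halves-agree k p q (≤-reflexive (+-comm (6 + k) 1)))
    (xf-halves-agree k p q (m≤n+m (3 + k) 4)))
  step-fuel-irrelevant k 3 p@(s≤s _) q@(s≤s _) = cong (λ y → 5 + k + 2 * y)
    (xf-halves-agree k p q (m≤n+m (5 + k) 2))
  step-fuel-irrelevant k 0 p@(s≤s _) q@(s≤s _) = step-even-fuel-irrelevant k p q
  step-fuel-irrelevant k 2 p@(s≤s _) q@(s≤s _) = step-even-fuel-irrelevant k p q
  step-fuel-irrelevant k (suc (suc (suc (suc _)))) p@(s≤s _) q@(s≤s _) = step-even-fuel-irrelevant k p q

  step-even-fuel-irrelevant : ∀ {f g} k → 5 + k ≤ suc f → 5 + k ≤ suc g →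
    5 + k + (xf (suc f) ((6 + k) / 2) + xf (suc f) ((4 + k) / 2)) ≡
    5 + k + (xf (suc g) ((6 + k) / 2) + xf (suc g) ((4 + k) / 2))
  step-even-fuel-irrelevant k p q = cong (5 + k +_) (cong₂ _+_
    (xf-halves-agree k p q (m≤n+m (6 + k) 1))
    (xf-halves-agree k p q (m≤n+m (4 + k) 3)))

  xf-halves-agree : ∀ {f g m} k → 5 + k ≤ suc f → 5 + k ≤ suc g → m ≤ 7 + k →
                    xf (suc f) (m / 2) ≡ xf (suc g) (m / 2)
  xf-halves-agree {m = m} k p q m≤7+k =
    xf-fuel-irrelevant (m / 2) (≤-trans (half-≤ k m≤7+k) p) (≤-trans (half-≤ k m≤7+k) q)

xf≡x : ∀ {f j} → suc j ≤ f → xf f (suc j) ≡ x (suc j)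
xf≡x {j = j} le@(s≤s _) = xf-fuel-irrelevant (suc j) le ≤-refl

a+2s≤a+d+4s : ∀ a d s → a + s * 2 ≤ a + d + s * 4
a+2s≤a+d+4s a d s = +-mono-≤ (m≤m+n a d) (*-monoʳ-≤ s (m≤m+n 2 2))

x-half : ∀ a d s → xf (suc a + d + s * 4) ((suc a + suc a + s * 4) / 2) ≡ x (suc a + s * 2)
x-half a d s = begin
  xf f ((suc a + suc a + s * 4) / 2) ≡⟨ cong (λ m → xf f (m / 2)) doubled ⟩
  xf f ((suc a + s * 2) * 2 / 2)     ≡⟨ cong (xf f) (m*n/n≡m (suc a + s * 2) 2) ⟩
  xf f (suc a + s * 2)               ≡⟨ xf≡x (a+2s≤a+d+4s (suc a) d s) ⟩
  x (suc a + s * 2)                  ∎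
  where
  open ≡-Reasoning
  f = suc a + d + s * 4
  doubled : suc a + suc a + s * 4 ≡ (suc a + s * 2) * 2
  doubled = solve (a ∷ s ∷ [])

x[4s+6] : ∀ s → x (6 + s * 4) ≡ 5 + s * 4 + (x (3 + s * 2) + x (2 + s * 2))
x[4s+6] s = trans (cong (step (5 + s * 4) (6 + s * 4)) ([m+kn]%n≡m%n 6 s 4))
  (cong (5 + s * 4 +_) (cong₂ _+_ (x-half 2 2 s) (x-half 1 3 s)))

x[4s+7] : ∀ s → x (7 + s * 4) ≡ 6 + s * 4 + (x (3 + s * 2) + x (3 + s * 2))
x[4s+7] s = begin
  x (7 + s * 4)                       ≡⟨ cong (step (6 + s * 4) (7 + s * 4)) ([m+kn]%n≡m%n 7 s 4) ⟩
  6 + s * 4 + 2 * xf (6 + s * 4) ((6 + s * 4) / 2) ≡⟨ cong (λ y → 6 + s * 4 + 2 * y) (x-half 2 3 s) ⟩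
  6 + s * 4 + 2 * a₃                  ≡⟨ cong (λ y → 6 + s * 4 + (a₃ + y)) (+-identityʳ a₃) ⟩
  6 + s * 4 + (a₃ + a₃)               ∎
  where
  open ≡-Reasoning
  a₃ = x (3 + s * 2)

x[4s+8] : ∀ s → x (8 + s * 4) ≡ 7 + s * 4 + (x (4 + s * 2) + x (3 + s * 2))
x[4s+8] s = trans (cong (step (7 + s * 4) (8 + s * 4)) ([m+kn]%n≡m%n 8 s 4))
  (cong (7 + s * 4 +_) (cong₂ _+_ (x-half 3 3 s) (x-half 2 4 s)))

x[4s+9] : ∀ s → x (9 + s * 4) ≡ 8 + s * 4 + (x (5 + s * 2) + x (3 + s * 2))
x[4s+9] s = trans (cong (step (8 + s * 4) (9 + s * 4)) ([m+kn]%n≡m%n 9 s 4))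
  (cong (8 + s * 4 +_) (cong₂ _+_ upper (x-half 2 5 s)))
  where
  upper : xf (8 + s * 4) ((9 + s * 4 + 1) / 2) ≡ x (5 + s * 2)
  upper = trans (cong (λ m → xf (8 + s * 4) ((9 + m) / 2)) (+-comm (s * 4) 1)) (x-half 4 3 s)

Δx[4s+6] : ∀ s → Δ≡1+Δ x (6 + s * 4) (2 + s * 2)
Δx[4s+6] s = Δ≡1+Δ-intro (5 + s * 4) (x[4s+6] s) (x[4s+7] s) (xy∙z≈xz∙y (x (3 + s * 2)) _ _)

Δx[4s+7] : ∀ s → Δ≡1+Δ x (7 + s * 4) (3 + s * 2)
Δx[4s+7] s = Δ≡1+Δ-intro (6 + s * 4) (x[4s+7] s) (x[4s+8] s) (xy∙z≈zy∙x (x (4 + s * 2)) _ _)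

Δx[4s+8] : ∀ s → Δ≡1+Δ x (8 + s * 4) (4 + s * 2)
Δx[4s+8] s = Δ≡1+Δ-intro (7 + s * 4) (x[4s+8] s) (x[4s+9] s) (xy∙z≈zy∙x (x (5 + s * 2)) _ _)

Δx[4s+9] : ∀ s → Δ≡1+Δ x (9 + s * 4) (3 + s * 2)
Δx[4s+9] s = Δ≡1+Δ-intro (8 + s * 4) (x[4s+9] s) (x[4s+6] (suc s)) (xy∙z≈xz∙y (x (5 + s * 2)) _ _)

x-parityConvex : ParityConvex x
x-parityConvex = <-rec (λ n → Δ≤Δ x n (2 + n)) convex
  where
  convex : ∀ n → (∀ {m} → m < n → Δ≤Δ x m (2 + m)) → Δ≤Δ x n (2 + n)
  convex 0 _ = mkΔ≤Δ (≤ᵇ⇒≤ _ _ _)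
  convex 1 _ = mkΔ≤Δ (≤ᵇ⇒≤ _ _ _)
  convex 2 _ = mkΔ≤Δ (≤ᵇ⇒≤ _ _ _)
  convex 3 _ = mkΔ≤Δ (≤ᵇ⇒≤ _ _ _)
  convex 4 _ = mkΔ≤Δ (≤ᵇ⇒≤ _ _ _)
  convex 5 _ = mkΔ≤Δ (≤ᵇ⇒≤ _ _ _)
  convex (suc (suc (suc (suc (suc (suc t)))))) ih with t divMod 4
  ... | result s zero refl =
    Δ≡1+Δ-mono (Δx[4s+6] s) (Δx[4s+8] s) (ih (a+2s≤a+d+4s 3 3 s))
  ... | result s (suc zero) refl =
    Δ≡1+Δ-mono (Δx[4s+7] s) (Δx[4s+9] s) Δ≤Δ-refl
  ... | result s (suc (suc zero)) refl =
    Δ≡1+Δ-mono (Δx[4s+8] s) (Δx[4s+6] (suc s)) Δ≤Δ-refl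
  ... | result s (suc (suc (suc zero))) refl =
    Δ≡1+Δ-mono (Δx[4s+9] s) (Δx[4s+7] (suc s)) (ih (a+2s≤a+d+4s 4 5 s))

corollary3 : (n i : ℕ) → i + 3 ≤ n →
    x (n ∸ 1) + x (n ∸ 2) ≤ x (n ∸ 1 + i) + x (n ∸ 2 ∸ i)
corollary3 n i i+3≤n =
  subst (λ k → x k + x (n ∸ 2) ≤ x (k + i) + x (n ∸ 2 ∸ i)) 1+[n∸2]≡n∸1
    (ParityConvex⇒spread x-parityConvex (m+n≤o⇒m≤o∸n i i+2≤n))
  where
  i+2≤n : i + 2 ≤ n
  i+2≤n = ≤-trans (+-monoʳ-≤ i (n≤1+n 2)) i+3≤n
  1+[n∸2]≡n∸1 : 1 + (n ∸ 2) ≡ n ∸ 1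
  1+[n∸2]≡n∸1 = sym (+-∸-assoc 1 (≤-trans (m≤n+m 2 i) i+2≤n))
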